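{- Let $G=(V,E)$ be a graph on $n$ vertices. Then for every $k\in\{0,\ldots,n-1\}$, $$p(G;n-k)=\big|\{S\subseteq V : |S|=k,\ S\cap N(V\setminus S)\text{ is a zero forcing set of } G[S]\}\big|.$$
   Context: Graphs are finite and simple. For $S\subseteq V$, color the vertices of $S$; then (domination step) every neighbor of a vertex of $S$ becomes colored; then repeatedly (forcing steps), whenever a colored vertex has exactly one uncolored neighbor, that neighbor becomes colored, until no more changes occur. $S$ is a power dominating set of $G$ if all vertices end up colored; $p(G;i)$ is the number of power dominating sets of $G$ of size $i$. A set $S$ is a zero forcing set of a graph $H$ if coloring $S$ and applying only the forcing rule (no domination step) repeatedly colors all vertices of $H$. For $T\subseteq V$, $N(T)=\left(\bigcup_{v\in T}N(v)\right)\setminus T$, where $N(v)$ is the set of neighbors of $v$. $G[S]$ is the subgraph induced by $S$. -}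

module Defs where

open import Data.Bool using (Bool; true; false; _∧_; _∨_; not; if_then_else_)
open import Data.Nat using (ℕ; zero; suc; _≡ᵇ_)
open import Data.Fin using (Fin)
open import Data.Fin.Subset using (Subset; _∩_; _∪_; _─_; ∁; ⊤; ∣_∣)
open import Data.Vec using (Vec; []; _∷_; lookup; tabulate)
open import Data.List using (List; []; _∷_; _++_; map; filterᵇ; length; allFin)
open import Data.Bool.ListAction using (any; all)
open import Relation.Binary.PropositionalEquality using (_≡_)

record Graph (n : ℕ) : Set where
  field
    Adj       : Fin n → Fin n → Bool
    Adj-sym   : ∀ u v → Adj u v ≡ Adj v u
    Adj-irrefl : ∀ v → Adj v v ≡ false
open Graph public

_∈ᵇ_ : ∀ {n} → Fin n → Subset n → Bool
v ∈ᵇ S = lookup S v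

nbhd : ∀ {n} → Graph n → Fin n → Subset n
nbhd G v = tabulate (λ w → Adj G v w)

N : ∀ {n} → Graph n → Subset n → Subset n
N G T = tabulate (λ w → any (λ v → (v ∈ᵇ T) ∧ Adj G v w) (allFin _)) ─ T

uncoloredNbrs : ∀ {n} → Graph n → (U C : Subset n) → Fin n → ℕ
uncoloredNbrs G U C u =
  length (filterᵇ (λ x → (x ∈ᵇ U) ∧ Adj G u x ∧ not (x ∈ᵇ C)) (allFin _))

forceStep : ∀ {n} → Graph n → (U C : Subset n) → Subset n
forceStep G U C = C ∪ tabulate (λ w →
  (w ∈ᵇ U) ∧ not (w ∈ᵇ C) ∧
  any (λ u → (u ∈ᵇ U) ∧ (u ∈ᵇ C) ∧ Adj G u w ∧ (uncoloredNbrs G U C u ≡ᵇ 1))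
      (allFin _))

iterate : ∀ {A : Set} → ℕ → (A → A) → A → A
iterate zero    f a = a
iterate (suc k) f a = iterate k f (f a)

-- Every round that changes
-- the colored set colors at least one new vertex, so after n rounds the
-- process has certainly stabilised; hence n rounds = "until no change".
forceClosure : ∀ {n} → Graph n → (U C : Subset n) → Subset n
forceClosure {n} G U C = iterate n (forceStep G U) C

covers : ∀ {n} → (U C : Subset n) → Bool
covers U C = all (λ v → not (v ∈ᵇ U) ∨ (v ∈ᵇ C)) (allFin _)

subsetOf : ∀ {n} → Subset n → Subset n → Bool
subsetOf T U = all (λ v → not (v ∈ᵇ T) ∨ (v ∈ᵇ U)) (allFin _)

isZeroForcingSetInduced : ∀ {n} → Graph n → (U T : Subset n) → Bool
isZeroForcingSetInduced G U T = subsetOf T U ∧ covers U (forceClosure G U T)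

isPowerDominating : ∀ {n} → Graph n → Subset n → Bool
isPowerDominating G S = covers ⊤ (forceClosure G ⊤ (S ∪ N G S))

allSubsets : (n : ℕ) → List (Subset n)
allSubsets zero    = [] ∷ []
allSubsets (suc n) = map (false ∷_) (allSubsets n) ++ map (true ∷_) (allSubsets n)

countSubsets : ∀ {n} → ℕ → (Subset n → Bool) → ℕ
countSubsets {n} i P = length (filterᵇ (λ S → (∣ S ∣ ≡ᵇ i) ∧ P S) (allSubsets n))

p : ∀ {n} → Graph n → ℕ → ℕ
p G i = countSubsets i (isPowerDominating G)

module Submission where

-- Let S ⊆ V and D = V ∖ S.  Colouring D and then its neighbourhood colours
-- D ∪ N(D) = D ∪ X₀ with X₀ = S ∩ N(D).  From then on every vertex of D is
-- coloured, so (i) a vertex u ∈ S has the same number of uncoloured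
-- neighbours in G as in G[S], and (ii) an uncoloured vertex w has no
-- neighbour in D, since all of S ∩ N(D) is already coloured.  Hence a
-- forcing round of G from D ∪ X equals D ∪ (a forcing round of G[S] from X),
-- whenever X contains S ∩ N(D).  Iterating, D is power dominating in G iff
-- X₀ is a zero forcing set of G[S].

open import Defs
open import Data.Nat using (ℕ; _<_; _∸_)
open import Data.Bool using (true)
open import Data.Fin.Subset using (Subset; _∩_; ∁)
open import Relation.Binary.PropositionalEquality using (_≡_)

open import Function using (_∘_; mk⇔)
open import Data.Bool using (Bool; false; _∧_; _∨_; not)
open import Data.Bool.Properties using (∧-zeroʳ; ∧-identityʳ; ∨-zeroʳ)
open import Data.Bool.ListAction using (any; all; and; or)
open import Data.Nat using (zero; suc; _+_; _≤_; _≡ᵇ_; _≟_)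
open import Data.Nat.Properties using (+-comm; ∸-cancelˡ-≡; <⇒≤)
open import Data.Fin using (Fin)
open import Data.Fin.Subset using (_∪_; _─_; ⊤; ∣_∣)
open import Data.Fin.Subset.Properties using (∣∁p∣≡n∸∣p∣; ∣p∣≤n)
open import Data.Vec as Vec using (Vec; _∷_; lookup; tabulate)
open import Data.Vec.Properties
  using (lookup-zipWith; lookup-map; lookup∘tabulate; lookup-replicate; tabulate∘lookup; tabulate-cong)
open import Data.List using (List; []; _∷_; _++_; map; filterᵇ; length; allFin)
open import Data.List.Properties using (filter-++; length-++; map-cong)
open import Data.List.Membership.Propositional using (_∈_)
open import Data.List.Membership.Propositional.Properties using (∈-allFin)
open import Data.List.Relation.Unary.Any using (here; there)
open import Relation.Nullary.Decidable using (T?; does-⇔)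
open import Relation.Binary.PropositionalEquality
  using (_≗_; refl; sym; trans; cong; cong₂; module ≡-Reasoning)

open ≡-Reasoning

count : ∀ {A : Set} → (A → Bool) → List A → ℕ
count P xs = length (filterᵇ P xs)

count-cong : ∀ {A : Set} {P Q : A → Bool} → P ≗ Q → count P ≗ count Q
count-cong e [] = refl
count-cong {P = P} {Q} e (x ∷ xs) with P x | Q x | e x
... | true  | .true  | refl = cong suc (count-cong e xs)
... | false | .false | refl = count-cong e xs

count-++ : ∀ {A : Set} (P : A → Bool) (xs ys : List A) →
           count P (xs ++ ys) ≡ count P xs + count P ys
count-++ P xs ys =
  trans (cong length (filter-++ (T? ∘ P) xs ys)) (length-++ (filterᵇ P xs))

count-map : ∀ {A B : Set} (P : B → Bool) (f : A → B) (xs : List A) →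
            count P (map f xs) ≡ count (P ∘ f) xs
count-map P f [] = refl
count-map P f (x ∷ xs) with P (f x)
... | true  = cong suc (count-map P f xs)
... | false = count-map P f xs

count-allSubsets-suc : ∀ {n} (P : Subset (suc n) → Bool) →
  count P (allSubsets (suc n)) ≡
  count (λ S → P (false ∷ S)) (allSubsets n) + count (λ S → P (true ∷ S)) (allSubsets n)
count-allSubsets-suc {n} P = begin
  count P (map (false ∷_) A ++ map (true ∷_) A)
    ≡⟨ count-++ P (map (false ∷_) A) (map (true ∷_) A) ⟩
  count P (map (false ∷_) A) + count P (map (true ∷_) A)
    ≡⟨ cong₂ _+_ (count-map P (false ∷_) A) (count-map P (true ∷_) A) ⟩
  count (λ S → P (false ∷ S)) A + count (λ S → P (true ∷ S)) A ∎
  where A = allSubsets n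

count-∁ : ∀ n (P : Subset n → Bool) →
          count P (allSubsets n) ≡ count (P ∘ ∁) (allSubsets n)
count-∁ zero P with P Vec.[]
... | true  = refl
... | false = refl
count-∁ (suc n) P = begin
  count P (allSubsets (suc n))
    ≡⟨ count-allSubsets-suc P ⟩
  count (λ S → P (false ∷ S)) A + count (λ S → P (true ∷ S)) A
    ≡⟨ cong₂ _+_ (count-∁ n _) (count-∁ n _) ⟩
  count (λ S → P (false ∷ ∁ S)) A + count (λ S → P (true ∷ ∁ S)) A
    ≡⟨ +-comm (count (λ S → P (false ∷ ∁ S)) A) _ ⟩
  count (λ S → P (true ∷ ∁ S)) A + count (λ S → P (false ∷ ∁ S)) A
    ≡⟨ sym (count-allSubsets-suc (P ∘ ∁)) ⟩
  count (P ∘ ∁) (allSubsets (suc n)) ∎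
  where A = allSubsets n

any-witness : ∀ {A : Set} (P : A → Bool) {x : A} {xs : List A} →
              x ∈ xs → P x ≡ true → any P xs ≡ true
any-witness P {xs = y ∷ ys} (here refl) Px rewrite Px = refl
any-witness P {xs = y ∷ ys} (there x∈ys) Px with P y
... | true  = refl
... | false = any-witness P x∈ys Px

all-true : ∀ {A : Set} (P : A → Bool) (xs : List A) →
           (∀ x → P x ≡ true) → all P xs ≡ true
all-true P [] _ = refl
all-true P (x ∷ xs) Pall rewrite Pall x = all-true P xs Pall

lookup-ext : ∀ {A : Set} {n} {xs ys : Vec A n} →
             (∀ i → lookup xs i ≡ lookup ys i) → xs ≡ ys
lookup-ext {xs = xs} {ys} e =
  trans (sym (tabulate∘lookup xs)) (trans (tabulate-cong e) (tabulate∘lookup ys))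

module _ {n : ℕ} where

  lookup-∪ : ∀ (A B : Subset n) i → lookup (A ∪ B) i ≡ lookup A i ∨ lookup B i
  lookup-∪ A B i = lookup-zipWith _∨_ i A B

  lookup-∩ : ∀ (A B : Subset n) i → lookup (A ∩ B) i ≡ lookup A i ∧ lookup B i
  lookup-∩ A B i = lookup-zipWith _∧_ i A B

  lookup-∁ : ∀ (A : Subset n) i → lookup (∁ A) i ≡ not (lookup A i)
  lookup-∁ A i = lookup-map i not A

  lookup-⊤ : ∀ (i : Fin n) → lookup ⊤ i ≡ true
  lookup-⊤ i = lookup-replicate i true

lookup-─ : ∀ {n} (A B : Subset n) i → lookup (A ─ B) i ≡ lookup A i ∧ not (lookup B i)
lookup-─ (a ∷ A) (true  ∷ B) Fin.zero = sym (∧-zeroʳ a)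
lookup-─ (a ∷ A) (false ∷ B) Fin.zero = sym (∧-identityʳ a)
lookup-─ (a ∷ A) (b ∷ B) (Fin.suc i) = lookup-─ A B i

lookup-N : ∀ {n} (G : Graph n) (T : Subset n) w →
  lookup (N G T) w ≡ any (λ v → (v ∈ᵇ T) ∧ Adj G v w) (allFin _) ∧ not (lookup T w)
lookup-N G T w = begin
  lookup (touches ─ T) w                      ≡⟨ lookup-─ touches T w ⟩
  lookup touches w ∧ not (lookup T w)         ≡⟨ cong (_∧ not (lookup T w)) (lookup∘tabulate _ w) ⟩
  any (λ v → (v ∈ᵇ T) ∧ Adj G v w) (allFin _) ∧ not (lookup T w) ∎
  where
  touches : Subset _
  touches = tabulate (λ x → any (λ v → (v ∈ᵇ T) ∧ Adj G v x) (allFin _))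

forcedBy : ∀ {n} → Graph n → (U C : Subset n) → Fin n → Bool
forcedBy G U C w =
  any (λ u → (u ∈ᵇ U) ∧ (u ∈ᵇ C) ∧ Adj G u w ∧ (uncoloredNbrs G U C u ≡ᵇ 1)) (allFin _)

lookup-forceStep : ∀ {n} (G : Graph n) (U C : Subset n) w →
  lookup (forceStep G U C) w ≡
    lookup C w ∨ (lookup U w ∧ not (lookup C w) ∧ forcedBy G U C w)
lookup-forceStep G U C w =
  trans (lookup-∪ C _ w) (cong (lookup C w ∨_) (lookup∘tabulate _ w))

forceStep-extensive : ∀ {n} (G : Graph n) (U C : Subset n) w →
  lookup C w ≡ true → lookup (forceStep G U C) w ≡ true
forceStep-extensive G U C w Cw rewrite lookup-forceStep G U C w | Cw = refl

module Simulation {n} (G : Graph n) (S : Subset n) where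

  D : Subset n
  D = ∁ S

  Absorbs : Subset n → Set
  Absorbs X = ∀ u w → lookup S u ≡ false → lookup S w ≡ true →
              Adj G u w ≡ true → lookup X w ≡ true

  -- The invariant survives forcing in G[S], since forcing only adds colour.
  absorbs-forceStep : ∀ X → Absorbs X → Absorbs (forceStep G S X)
  absorbs-forceStep X abs u w Su Sw uw =
    forceStep-extensive G S X w (abs u w Su Sw uw)

  no-edge-from-D : ∀ X → Absorbs X → ∀ u w → lookup S u ≡ false →
                   lookup S w ≡ true → lookup X w ≡ false → Adj G u w ≡ false
  no-edge-from-D X abs u w Su Sw Xw with Adj G u w in uw
  ... | false = refl
  ... | true with trans (sym (abs u w Su Sw uw)) Xw
  ...   | ()

  uncolored-agree : ∀ X u → uncoloredNbrs G ⊤ (D ∪ X) u ≡ uncoloredNbrs G S X u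
  uncolored-agree X u = count-cong uncolored-at (allFin _)
    where
    uncolored-at : ∀ x → lookup ⊤ x ∧ Adj G u x ∧ not (lookup (D ∪ X) x)
                       ≡ lookup S x ∧ Adj G u x ∧ not (lookup X x)
    uncolored-at x rewrite lookup-⊤ x | lookup-∪ D X x | lookup-∁ S x with lookup S x
    ... | true  = refl
    ... | false = ∧-zeroʳ (Adj G u x)

  -- An uncoloured vertex of S is forced in G iff it is forced in G[S]:
  -- its potential forcers in D are not adjacent to it.
  forcedBy-agree : ∀ X → Absorbs X → ∀ w → lookup S w ≡ true → lookup X w ≡ false →
                   forcedBy G ⊤ (D ∪ X) w ≡ forcedBy G S X w
  forcedBy-agree X abs w Sw Xw = cong or (map-cong forcer-at (allFin _))
    where
    forcer-at : ∀ u →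
      lookup ⊤ u ∧ lookup (D ∪ X) u ∧ Adj G u w ∧ (uncoloredNbrs G ⊤ (D ∪ X) u ≡ᵇ 1)
      ≡ lookup S u ∧ lookup X u ∧ Adj G u w ∧ (uncoloredNbrs G S X u ≡ᵇ 1)
    forcer-at u rewrite uncolored-agree X u | lookup-⊤ u | lookup-∪ D X u | lookup-∁ S u
      with lookup S u in Su
    ... | true  = refl
    ... | false rewrite no-edge-from-D X abs u w Su Sw Xw = refl

  forceStep-agree : ∀ X → Absorbs X → forceStep G ⊤ (D ∪ X) ≡ D ∪ forceStep G S X
  forceStep-agree X abs = lookup-ext at
    where
    at : ∀ w → lookup (forceStep G ⊤ (D ∪ X)) w ≡ lookup (D ∪ forceStep G S X) w
    at w rewrite lookup-forceStep G ⊤ (D ∪ X) w | lookup-∪ D (forceStep G S X) w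
               | lookup-forceStep G S X w | lookup-∪ D X w | lookup-⊤ w | lookup-∁ S w
      with lookup S w in Sw | lookup X w in Xw
    ... | false | _     = refl
    ... | true  | true  = refl
    ... | true  | false = forcedBy-agree X abs w Sw Xw

  iterate-agree : ∀ m X → Absorbs X →
    iterate m (forceStep G ⊤) (D ∪ X) ≡ D ∪ iterate m (forceStep G S) X
  iterate-agree zero X abs = refl
  iterate-agree (suc m) X abs rewrite forceStep-agree X abs =
    iterate-agree m (forceStep G S X) (absorbs-forceStep X abs)

  X₀ : Subset n
  X₀ = S ∩ N G D

  dominated-split : D ∪ N G D ≡ D ∪ X₀
  dominated-split = lookup-ext at
    where
    at : ∀ w → lookup (D ∪ N G D) w ≡ lookup (D ∪ X₀) w
    at w rewrite lookup-∪ D (N G D) w | lookup-∪ D X₀ w | lookup-∩ S (N G D) w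
               | lookup-∁ S w with lookup S w
    ... | true  = refl
    ... | false = refl

  D-neighbour : ∀ u w → lookup S u ≡ false → Adj G u w ≡ true →
                any (λ v → (v ∈ᵇ D) ∧ Adj G v w) (allFin _) ≡ true
  D-neighbour u w Su uw = any-witness _ (∈-allFin u) uD
    where
    uD : lookup D u ∧ Adj G u w ≡ true
    uD rewrite lookup-∁ S u | Su | uw = refl

  absorbs-X₀ : Absorbs X₀
  absorbs-X₀ u w Su Sw uw
    rewrite lookup-∩ S (N G D) w | Sw | lookup-N G D w | lookup-∁ S w | Sw
          | D-neighbour u w Su uw = refl

  X₀⊆S : subsetOf X₀ S ≡ true
  X₀⊆S = all-true _ (allFin _) at
    where
    at : ∀ v → not (lookup X₀ v) ∨ lookup S v ≡ true
    at v rewrite lookup-∩ S (N G D) v with lookup S v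
    ... | true  = ∨-zeroʳ _
    ... | false = refl

  covers-agree : ∀ Y → covers ⊤ (D ∪ Y) ≡ covers S Y
  covers-agree Y = cong and (map-cong at (allFin _))
    where
    at : ∀ v → not (lookup ⊤ v) ∨ lookup (D ∪ Y) v ≡ not (lookup S v) ∨ lookup Y v
    at v rewrite lookup-⊤ v | lookup-∪ D Y v | lookup-∁ S v = refl

  powerDominating-complement :
    isPowerDominating G D ≡ isZeroForcingSetInduced G S X₀
  powerDominating-complement = begin
    covers ⊤ (forceClosure G ⊤ (D ∪ N G D))
      ≡⟨ cong (covers ⊤ ∘ forceClosure G ⊤) dominated-split ⟩
    covers ⊤ (forceClosure G ⊤ (D ∪ X₀))
      ≡⟨ cong (covers ⊤) (iterate-agree n X₀ absorbs-X₀) ⟩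
    covers ⊤ (D ∪ forceClosure G S X₀)
      ≡⟨ covers-agree _ ⟩
    covers S (forceClosure G S X₀)
      ≡⟨ cong (_∧ covers S (forceClosure G S X₀)) (sym X₀⊆S) ⟩
    isZeroForcingSetInduced G S X₀ ∎

∸-≡ᵇ-cancelˡ : ∀ {n a k} → a ≤ n → k ≤ n → (n ∸ a ≡ᵇ n ∸ k) ≡ (a ≡ᵇ k)
∸-≡ᵇ-cancelˡ {n} {a} {k} a≤n k≤n =
  does-⇔ (mk⇔ (∸-cancelˡ-≡ a≤n k≤n) (cong (n ∸_))) (n ∸ a ≟ n ∸ k) (a ≟ k)

complement-size : ∀ {n k} → k ≤ n → (S : Subset n) →
                  (∣ ∁ S ∣ ≡ᵇ n ∸ k) ≡ (∣ S ∣ ≡ᵇ k)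
complement-size {n} {k} k≤n S =
  trans (cong (_≡ᵇ n ∸ k) (∣∁p∣≡n∸∣p∣ S)) (∸-≡ᵇ-cancelˡ (∣p∣≤n S) k≤n)

theorem6 : ∀ {n} (G : Graph n) (k : ℕ) → k < n →
    p G (n ∸ k) ≡ countSubsets k (λ S → isZeroForcingSetInduced G S (S ∩ N G (∁ S)))
theorem6 {n} G k k<n = begin
  p G (n ∸ k)
    ≡⟨ count-∁ n _ ⟩
  count (λ S → (∣ ∁ S ∣ ≡ᵇ n ∸ k) ∧ isPowerDominating G (∁ S)) (allSubsets n)
    ≡⟨ count-cong (λ S → cong₂ _∧_ (complement-size (<⇒≤ k<n) S)
                                   (Simulation.powerDominating-complement G S))
                  (allSubsets n) ⟩
  countSubsets k (λ S → isZeroForcingSetInduced G S (S ∩ N G (∁ S))) ∎
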